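{- Let $G$ be a multigraph on $n$ vertices whose edges are colored with $n-1$ colors so that each color class is a spanning star, and suppose the centers of all these $n-1$ monochromatic stars lie in a set of two vertices $\{k,j\}$ of $G$. Then $G$ can be decomposed into $n-1$ pairwise edge-disjoint rainbow spanning trees.
   Context: A star is a set of edges forming a tree in which one vertex (the center) is incident to every edge; it is spanning if every vertex of $G$ is incident to one of its edges. A spanning tree is an acyclic set of $n-1$ edges meeting every vertex. A subgraph is rainbow if all its edges have distinct colors. Parallel edges are distinct edges. -}

module Defs where

open import Data.Nat using (ℕ; zero; suc; _∸_)
open import Data.Fin using (Fin; zero; suc)
open import Data.Fin.Subset using (Subset; _∈_; ∣_∣)
open import Data.Vec using (tabulate)
open import Data.Product using (Σ; ∃; _×_; _,_)
open import Data.Sum using (_⊎_)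
open import Relation.Nullary using (¬_; does)
open import Relation.Binary.PropositionalEquality using (_≡_; _≢_)
import Data.Fin as F

-- A multigraph on vertex set Fin n with m edges (indexed by Fin m);
-- each edge has two (unordered) endpoints; loops and parallel edges allowed.
record Multigraph (n : ℕ) : Set where
  field
    m    : ℕ
    ends : Fin m → Fin n × Fin n

module _ {n : ℕ} (G : Multigraph n) where
  open Multigraph G

  Edge : Set
  Edge = Fin m

  Incident : Edge → Fin n → Set
  Incident e v with ends e
  ... | (a , b) = (a ≡ v) ⊎ (b ≡ v)

  Joins : Edge → Fin n → Fin n → Set
  Joins e u v = (ends e ≡ (u , v)) ⊎ (ends e ≡ (v , u))

  sucMod : ∀ {k} → Fin (suc k) → Fin (suc k)
  sucMod {zero} zero = zero
  sucMod {suc k} zero = suc zero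
  sucMod {suc k} (suc i) with sucMod {k} i
  ... | zero = zero
  ... | suc j = suc (suc j)

  -- a cycle in the edge set S: k+1 distinct edges e_0..e_k in S and
  -- k+1 distinct vertices v_0..v_k with e_i joining v_i and v_{i+1 mod (k+1)}.
  -- (k = 0: a loop; k = 1: two parallel edges.)
  record Cycle (S : Subset m) : Set where
    field
      k      : ℕ
      es     : Fin (suc k) → Edge
      vs     : Fin (suc k) → Fin n
      es-inj : ∀ i i′ → es i ≡ es i′ → i ≡ i′
      vs-inj : ∀ i i′ → vs i ≡ vs i′ → i ≡ i′
      es-in  : ∀ i → es i ∈ S
      joins  : ∀ i → Joins (es i) (vs i) (vs (sucMod i))

  Acyclic : Subset m → Set
  Acyclic S = ¬ Cycle S

  Spanning : Subset m → Set
  Spanning S = ∀ v → ∃ λ e → e ∈ S × Incident e v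

  SpanningTree : Subset m → Set
  SpanningTree S = (∣ S ∣ ≡ n ∸ 1) × Acyclic S × Spanning S

  SpanningStarWithCenter : Subset m → Fin n → Set
  SpanningStarWithCenter S v = SpanningTree S × (∀ e → e ∈ S → Incident e v)

  Rainbow : {C : Set} → (Edge → C) → Subset m → Set
  Rainbow col S = ∀ e e′ → e ∈ S → e′ ∈ S → col e ≡ col e′ → e ≡ e′

  ColorClass : ∀ {c} → (Edge → Fin c) → Fin c → Subset m
  ColorClass col i = tabulate (λ e → does (col e F.≟ i))

  Decomposition : ∀ {t} → (Fin t → Subset m) → Set
  Decomposition T = ∀ e → ∃ λ i → (e ∈ T i) × (∀ i′ → e ∈ T i′ → i′ ≡ i)

{-# OPTIONS --safe #-}
-- Collapse the two centres k and j to a single point: the n vertices then have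
-- exactly n - 1 images, and every edge gets the label ℓ(e) = image of its end that is
-- not a centre (an edge kj gets the image of the centres).  Within a colour class,
-- i.e. a spanning star, ℓ is a bijection onto the n - 1 images.  Put e into the tree
-- numbered ℓ(e) + col(e) mod (n - 1).  By the Latin-square property of addition each
-- tree contains exactly one edge of each colour and one edge of each label.  Hence a
-- non-centre x lies on exactly one edge of each tree (the one labelled by its image),
-- so no cycle passes through it, and a cycle through k and j alone would consist of
-- two parallel edges kj, which carry the same label.
module Submission where

open import Defs
open import Data.Empty using (⊥; ⊥-elim)
open import Data.Fin using (Fin; zero; suc; toℕ; _≟_; punchIn; punchOut; fromℕ)
open import Data.Fin.Properties
  using (toℕ-injective; toℕ-fromℕ<; toℕ<n; punchOut-cong; punchOut-injective;
         punchInᵢ≢i; punchOut-punchIn; cantor-schröder-bernstein; suc-injective)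
open import Data.Fin.Subset using (Subset; _∈_; ∣_∣; inside; outside)
open import Data.Nat using (ℕ; zero; suc; _+_; _∸_; _%_; NonZero)
open import Data.Nat.DivMod using (_mod_; %-distribˡ-+; m%n%n≡m%n; [m+n]%n≡m%n; m<n⇒m%n≡m)
open import Data.Nat.Properties using (+-assoc; +-comm; m+[n∸m]≡n; m∸n+n≡m; <⇒≤)
open import Data.Product using (∃; _×_; _,_; proj₁; proj₂)
open import Data.Sum using (_⊎_; inj₁; inj₂; [_,_])
open import Data.Vec using (_∷_; tabulate)
open import Data.Vec.Properties using (lookup∘tabulate; lookup⇒[]=; []=⇒lookup)
open import Data.Vec.Base using (here; there)
open import Function using (_∘_)
open import Relation.Nullary using (¬_; Dec; does; yes; no)
open import Relation.Nullary.Decidable using (_⊎-dec_)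
open import Relation.Binary.PropositionalEquality
  using (_≡_; _≢_; refl; sym; trans; cong; cong₂; subst; module ≡-Reasoning)

pair-pigeonhole : ∀ {A : Set} {k j a b c : A} →
  a ≡ k ⊎ a ≡ j → b ≡ k ⊎ b ≡ j → c ≡ k ⊎ c ≡ j → a ≡ b ⊎ a ≡ c ⊎ b ≡ c
pair-pigeonhole (inj₁ refl) (inj₁ refl) _           = inj₁ refl
pair-pigeonhole (inj₂ refl) (inj₂ refl) _           = inj₁ refl
pair-pigeonhole (inj₁ refl) (inj₂ refl) (inj₁ refl) = inj₂ (inj₁ refl)
pair-pigeonhole (inj₁ refl) (inj₂ refl) (inj₂ refl) = inj₂ (inj₂ refl)
pair-pigeonhole (inj₂ refl) (inj₁ refl) (inj₂ refl) = inj₂ (inj₁ refl)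
pair-pigeonhole (inj₂ refl) (inj₁ refl) (inj₁ refl) = inj₂ (inj₂ refl)

module Modular {N : ℕ} .{{_ : NonZero N}} where

  infixl 6 _⊕_ _⊖_

  _⊕_ : Fin N → Fin N → Fin N
  a ⊕ b = (toℕ a + toℕ b) mod N

  _⊖_ : Fin N → Fin N → Fin N
  a ⊖ b = (toℕ a + (N ∸ toℕ b)) mod N

  toℕ-mod : ∀ x → toℕ (x mod N) ≡ x % N
  toℕ-mod x = toℕ-fromℕ< _

  [m%n+o]%n≡[m+o]%n : ∀ x y → (x % N + y) % N ≡ (x + y) % N
  [m%n+o]%n≡[m+o]%n x y = begin
    (x % N + y) % N             ≡⟨ %-distribˡ-+ (x % N) y N ⟩
    (x % N % N + y % N) % N     ≡⟨ cong (λ z → (z + y % N) % N) (m%n%n≡m%n x N) ⟩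
    (x % N + y % N) % N         ≡⟨ %-distribˡ-+ x y N ⟨
    (x + y) % N                 ∎
    where open ≡-Reasoning

  shift-by-N : ∀ (a : Fin N) {x y} → x + y ≡ N → ((toℕ a + x) % N + y) % N ≡ toℕ a
  shift-by-N a {x} {y} x+y≡N = begin
    ((toℕ a + x) % N + y) % N   ≡⟨ [m%n+o]%n≡[m+o]%n (toℕ a + x) y ⟩
    (toℕ a + x + y) % N         ≡⟨ cong (_% N) (trans (+-assoc (toℕ a) x y) (cong (toℕ a +_) x+y≡N)) ⟩
    (toℕ a + N) % N             ≡⟨ [m+n]%n≡m%n (toℕ a) N ⟩
    toℕ a % N                   ≡⟨ m<n⇒m%n≡m (toℕ<n a) ⟩
    toℕ a                       ∎
    where open ≡-Reasoning

  ⊕-⊖-cancel : ∀ a b → a ⊕ b ⊖ b ≡ a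
  ⊕-⊖-cancel a b = toℕ-injective (begin
    toℕ (a ⊕ b ⊖ b)                            ≡⟨ toℕ-mod _ ⟩
    (toℕ (a ⊕ b) + (N ∸ toℕ b)) % N            ≡⟨ cong (λ z → (z + (N ∸ toℕ b)) % N) (toℕ-mod _) ⟩
    ((toℕ a + toℕ b) % N + (N ∸ toℕ b)) % N    ≡⟨ shift-by-N a (m+[n∸m]≡n (<⇒≤ (toℕ<n b))) ⟩
    toℕ a                                      ∎)
    where open ≡-Reasoning

  ⊖-⊕-cancel : ∀ a b → a ⊖ b ⊕ b ≡ a
  ⊖-⊕-cancel a b = toℕ-injective (begin
    toℕ (a ⊖ b ⊕ b)                            ≡⟨ toℕ-mod _ ⟩
    (toℕ (a ⊖ b) + toℕ b) % N                  ≡⟨ cong (λ z → (z + toℕ b) % N) (toℕ-mod _) ⟩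
    ((toℕ a + (N ∸ toℕ b)) % N + toℕ b) % N    ≡⟨ shift-by-N a (m∸n+n≡m (<⇒≤ (toℕ<n b))) ⟩
    toℕ a                                      ∎)
    where open ≡-Reasoning

  ⊕-comm : ∀ a b → a ⊕ b ≡ b ⊕ a
  ⊕-comm a b = cong (_mod N) (+-comm (toℕ a) (toℕ b))

  ⊕-cancelʳ : ∀ {a a′} b → a ⊕ b ≡ a′ ⊕ b → a ≡ a′
  ⊕-cancelʳ {a} {a′} b eq = begin
    a            ≡⟨ ⊕-⊖-cancel a b ⟨
    a ⊕ b ⊖ b    ≡⟨ cong (_⊖ b) eq ⟩
    a′ ⊕ b ⊖ b   ≡⟨ ⊕-⊖-cancel a′ b ⟩
    a′           ∎
    where open ≡-Reasoning

  ⊕-cancelˡ : ∀ a {b b′} → a ⊕ b ≡ a ⊕ b′ → b ≡ b′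
  ⊕-cancelˡ a {b} {b′} eq = ⊕-cancelʳ a (trans (⊕-comm b a) (trans eq (⊕-comm a b′)))

nth : ∀ {m} (p : Subset m) → Fin ∣ p ∣ → Fin m
nth (inside ∷ p)  zero    = zero
nth (inside ∷ p)  (suc i) = suc (nth p i)
nth (outside ∷ p) i       = suc (nth p i)

nth∈ : ∀ {m} (p : Subset m) i → nth p i ∈ p
nth∈ (inside ∷ p)  zero    = here
nth∈ (inside ∷ p)  (suc i) = there (nth∈ p i)
nth∈ (outside ∷ p) i       = there (nth∈ p i)

nth-injective : ∀ {m} (p : Subset m) {i i′} → nth p i ≡ nth p i′ → i ≡ i′
nth-injective (inside ∷ p)  {zero}  {zero}   _  = refl
nth-injective (inside ∷ p)  {suc i} {suc i′} eq = cong suc (nth-injective p (suc-injective eq))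
nth-injective (outside ∷ p) eq                  = nth-injective p (suc-injective eq)

position : ∀ {m} (p : Subset m) {x} → x ∈ p → Fin ∣ p ∣
position (inside ∷ p)  here      = zero
position (inside ∷ p)  (there q) = suc (position p q)
position (outside ∷ p) (there q) = position p q

nth-position : ∀ {m} (p : Subset m) {x} (q : x ∈ p) → nth p (position p q) ≡ x
nth-position (inside ∷ p)  here      = refl
nth-position (inside ∷ p)  (there q) = cong suc (nth-position p q)
nth-position (outside ∷ p) (there q) = cong suc (nth-position p q)

bijection⇒∣p∣≡n : ∀ {m n} (p : Subset m) (f : Fin m → Fin n) (g : Fin n → Fin m) →
  (∀ {x y} → x ∈ p → y ∈ p → f x ≡ f y → x ≡ y) →
  (∀ c → g c ∈ p) → (∀ c → f (g c) ≡ c) → ∣ p ∣ ≡ n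
bijection⇒∣p∣≡n p f g f-injective g∈p f∘g≗id =
  cantor-schröder-bernstein f∘nth-injective position∘g-injective
  where
  f∘nth-injective : ∀ {i i′} → f (nth p i) ≡ f (nth p i′) → i ≡ i′
  f∘nth-injective eq = nth-injective p (f-injective (nth∈ p _) (nth∈ p _) eq)

  position∘g-injective : ∀ {c c′} → position p (g∈p c) ≡ position p (g∈p c′) → c ≡ c′
  position∘g-injective {c} {c′} eq = begin
    c                                 ≡⟨ f∘g≗id c ⟨
    f (g c)                           ≡⟨ cong f (nth-position p (g∈p c)) ⟨
    f (nth p (position p (g∈p c)))    ≡⟨ cong (f ∘ nth p) eq ⟩
    f (nth p (position p (g∈p c′)))   ≡⟨ cong f (nth-position p (g∈p c′)) ⟩
    f (g c′)                          ≡⟨ f∘g≗id c′ ⟩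
    c′                                ∎
    where open ≡-Reasoning

fiber : ∀ {m t} → (Fin m → Fin t) → Fin t → Subset m
fiber f i = tabulate (λ e → does (f e ≟ i))

∈-fiber⁺ : ∀ {m t} (f : Fin m → Fin t) {i e} → f e ≡ i → e ∈ fiber f i
∈-fiber⁺ f {i} {e} fe≡i = lookup⇒[]= e _ (trans (lookup∘tabulate _ e) (holds (f e ≟ i)))
  where
  holds : (d : Dec (f e ≡ i)) → does d ≡ inside
  holds (yes _)    = refl
  holds (no fe≢i) = ⊥-elim (fe≢i fe≡i)

∈-fiber⁻ : ∀ {m t} (f : Fin m → Fin t) {i e} → e ∈ fiber f i → f e ≡ i
∈-fiber⁻ f {i} {e} e∈ = holds (f e ≟ i) (trans (sym (lookup∘tabulate _ e)) ([]=⇒lookup e∈))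
  where
  holds : (d : Dec (f e ≡ i)) → does d ≡ inside → f e ≡ i
  holds (yes fe≡i) _ = fe≡i

module MultigraphFacts {n : ℕ} (G : Multigraph n) where
  open Multigraph G using (m; ends)

  fiber-decomposition : ∀ {t} (f : Edge G → Fin t) → Decomposition G (fiber f)
  fiber-decomposition f e = f e , ∈-fiber⁺ f refl , λ i e∈ → sym (∈-fiber⁻ f e∈)

  Joins-sym : ∀ {e a b} → Joins G e a b → Joins G e b a
  Joins-sym (inj₁ p) = inj₂ p
  Joins-sym (inj₂ p) = inj₁ p

  Joins⇒Incidentˡ : ∀ {e a b} → Joins G e a b → Incident G e a
  Joins⇒Incidentˡ (inj₁ p) rewrite p = inj₁ refl
  Joins⇒Incidentˡ (inj₂ p) rewrite p = inj₂ refl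

  Joins⇒Incidentʳ : ∀ {e a b} → Joins G e a b → Incident G e b
  Joins⇒Incidentʳ = Joins⇒Incidentˡ ∘ Joins-sym

  Incident⇒Joins : ∀ {e v} → Incident G e v → ∃ λ w → Joins G e v w
  Incident⇒Joins {e} inc with ends e
  Incident⇒Joins inc | a , b with inc
  ... | inj₁ refl = b , inj₁ refl
  ... | inj₂ refl = a , inj₂ refl

  Joins-unique : ∀ {e a b c d} → Joins G e a b → Joins G e c d →
                 (a ≡ c × b ≡ d) ⊎ (a ≡ d × b ≡ c)
  Joins-unique (inj₁ p) (inj₁ q) with trans (sym p) q
  ... | refl = inj₁ (refl , refl)
  Joins-unique (inj₁ p) (inj₂ q) with trans (sym p) q
  ... | refl = inj₂ (refl , refl)
  Joins-unique (inj₂ p) (inj₁ q) with trans (sym p) q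
  ... | refl = inj₂ (refl , refl)
  Joins-unique (inj₂ p) (inj₂ q) with trans (sym p) q
  ... | refl = inj₁ (refl , refl)

  Loopless : Subset m → Set
  Loopless S = ∀ {e a} → e ∈ S → ¬ Joins G e a a

  NoParallelEdges : Subset m → Set
  NoParallelEdges S = ∀ {e e′ a b} → e ∈ S → e′ ∈ S → Joins G e a b → Joins G e′ a b → e ≡ e′

  DegreeAtMostOne : Subset m → Fin n → Set
  DegreeAtMostOne S x = ∀ {e e′ p q} → e ∈ S → e′ ∈ S → Joins G e x p → Joins G e′ x q → e ≡ e′

  loop⇒Cycle : ∀ {S e a} → e ∈ S → Joins G e a a → Cycle G S
  loop⇒Cycle {e = e} {a} e∈S e-loop = record
    { k = 0 ; es = λ _ → e ; vs = λ _ → a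
    ; es-inj = λ { zero zero _ → refl } ; vs-inj = λ { zero zero _ → refl }
    ; es-in = λ { zero → e∈S } ; joins = λ { zero → e-loop } }

  parallel⇒Cycle : ∀ {S e e′ a b} → e ∈ S → e′ ∈ S → e ≢ e′ → a ≢ b →
                   Joins G e a b → Joins G e′ a b → Cycle G S
  parallel⇒Cycle {e = e} {e′} {a} {b} e∈S e′∈S e≢e′ a≢b e-ab e′-ab = record
    { k      = 1
    ; es     = λ { zero → e ; (suc zero) → e′ }
    ; vs     = λ { zero → a ; (suc zero) → b }
    ; es-inj = λ { zero zero _ → refl ; zero (suc zero) p → ⊥-elim (e≢e′ p)
                 ; (suc zero) zero p → ⊥-elim (e≢e′ (sym p)) ; (suc zero) (suc zero) _ → refl }
    ; vs-inj = λ { zero zero _ → refl ; zero (suc zero) p → ⊥-elim (a≢b p)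
                 ; (suc zero) zero p → ⊥-elim (a≢b (sym p)) ; (suc zero) (suc zero) _ → refl }
    ; es-in  = λ { zero → e∈S ; (suc zero) → e′∈S }
    ; joins  = λ { zero → e-ab ; (suc zero) → Joins-sym e′-ab } }

  Acyclic⇒Loopless : ∀ {S} → Acyclic G S → Loopless S
  Acyclic⇒Loopless acyclic e∈S e-loop = acyclic (loop⇒Cycle e∈S e-loop)

  Acyclic⇒NoParallelEdges : ∀ {S} → Acyclic G S → NoParallelEdges S
  Acyclic⇒NoParallelEdges acyclic {e} {e′} {a} {b} e∈S e′∈S e-ab e′-ab with e ≟ e′ | a ≟ b
  ... | yes e≡e′ | _        = e≡e′
  ... | no _     | yes refl = ⊥-elim (Acyclic⇒Loopless acyclic e∈S e-ab)
  ... | no e≢e′  | no a≢b   = ⊥-elim (acyclic (parallel⇒Cycle e∈S e′∈S e≢e′ a≢b e-ab e′-ab))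

  sucMod-fromℕ : ∀ k → sucMod G (fromℕ k) ≡ zero
  sucMod-fromℕ zero    = refl
  sucMod-fromℕ (suc k) rewrite sucMod-fromℕ k = refl

  -- A cycle of length ≥ 3 has three distinct vertices, each meeting two distinct
  -- cycle edges; they cannot all lie in {u, v}.
  acyclic-if-degree≤1-off-pair : ∀ {S} (u v : Fin n) → Loopless S → NoParallelEdges S →
    (∀ x → x ≢ u → x ≢ v → DegreeAtMostOne S x) → Acyclic G S
  acyclic-if-degree≤1-off-pair {S} u v loopless no-parallel degree≤1 = refute
    where
    in-pair : ∀ {x e e′ p q} → e ∈ S → e′ ∈ S → e ≢ e′ →
              Joins G e x p → Joins G e′ x q → x ≡ u ⊎ x ≡ v
    in-pair {x} e∈S e′∈S e≢e′ e-xp e′-xq with x ≟ u | x ≟ v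
    ... | yes x≡u | _       = inj₁ x≡u
    ... | no _    | yes x≡v = inj₂ x≡v
    ... | no x≢u  | no x≢v  = ⊥-elim (e≢e′ (degree≤1 x x≢u x≢v e∈S e′∈S e-xp e′-xq))

    refute : Cycle G S → ⊥
    refute record { k = zero ; es-in = es-in ; joins = joins } =
      loopless (es-in zero) (joins zero)
    refute record { k = suc zero ; es-inj = es-inj ; es-in = es-in ; joins = joins }
      with es-inj zero (suc zero)
             (no-parallel (es-in zero) (es-in (suc zero)) (joins zero) (Joins-sym (joins (suc zero))))
    ... | ()
    refute record { k = suc (suc k) ; es = es ; vs = vs ; es-inj = es-inj ; vs-inj = vs-inj
                  ; es-in = es-in ; joins = joins } =
      [ vs≢ zero (suc zero) (λ ()) , [ vs≢ zero (suc (suc zero)) (λ ()) , vs≢ (suc zero) (suc (suc zero)) (λ ()) ] ]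
        (pair-pigeonhole
          (in-pair (es-in zero) (es-in last) (es≢ zero last (λ ())) (joins zero) closing)
          (in-pair (es-in zero) (es-in (suc zero)) (es≢ zero (suc zero) (λ ()))
                   (Joins-sym (joins zero)) (joins (suc zero)))
          (in-pair (es-in (suc zero)) (es-in (suc (suc zero))) (es≢ (suc zero) (suc (suc zero)) (λ ()))
                   (Joins-sym (joins (suc zero))) (joins (suc (suc zero)))))
      where
      last : Fin (suc (suc (suc k)))
      last = fromℕ (suc (suc k))

      closing : Joins G (es last) (vs zero) (vs last)
      closing = Joins-sym (subst (Joins G (es last) (vs last) ∘ vs) (sucMod-fromℕ (suc (suc k))) (joins last))

      es≢ : ∀ i i′ → i ≢ i′ → es i ≢ es i′
      es≢ i i′ i≢i′ = i≢i′ ∘ es-inj i i′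

      vs≢ : ∀ i i′ → i ≢ i′ → vs i ≢ vs i′
      vs≢ i i′ i≢i′ = i≢i′ ∘ vs-inj i i′

-- collapse sends j to the image hub of k and is a bijection from Fin (suc N) ∖ {j} onto Fin N.
module Collapse {N : ℕ} {k j : Fin (suc N)} (k≢j : k ≢ j) where

  Central : Fin (suc N) → Set
  Central v = v ≡ k ⊎ v ≡ j

  central? : ∀ v → Dec (Central v)
  central? v = (v ≟ k) ⊎-dec (v ≟ j)

  j≢k : j ≢ k
  j≢k = k≢j ∘ sym

  hub : Fin N
  hub = punchOut j≢k

  collapse : Fin (suc N) → Fin N
  collapse x with j ≟ x
  ... | yes _  = hub
  ... | no j≢x = punchOut j≢x

  collapse-central : ∀ {x} → Central x → collapse x ≡ hub
  collapse-central (inj₁ refl) with j ≟ k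
  ... | yes j≡k = ⊥-elim (j≢k j≡k)
  ... | no _    = punchOut-cong j refl
  collapse-central (inj₂ refl) with j ≟ j
  ... | yes _   = refl
  ... | no j≢j  = ⊥-elim (j≢j refl)

  collapse-noncentral : ∀ {x} → ¬ Central x → collapse x ≢ hub
  collapse-noncentral {x} ¬cx eq with j ≟ x
  ... | yes j≡x = ¬cx (inj₂ (sym j≡x))
  ... | no j≢x  = ¬cx (inj₁ (punchOut-injective j≢x j≢k eq))

  collapse-injective : ∀ {x y} → ¬ Central x → collapse x ≡ collapse y → x ≡ y
  collapse-injective {x} {y} ¬cx eq with j ≟ x | j ≟ y
  ... | yes j≡x | _       = ⊥-elim (¬cx (inj₂ (sym j≡x)))
  ... | no j≢x  | yes _   = ⊥-elim (¬cx (inj₁ (punchOut-injective j≢x j≢k eq)))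
  ... | no j≢x  | no j≢y  = punchOut-injective j≢x j≢y eq

  collapse-injective-off : ∀ {v x y} → Central v → x ≢ v → y ≢ v → collapse x ≡ collapse y → x ≡ y
  collapse-injective-off {v} {x} {y} cv x≢v y≢v eq with central? x | central? y
  ... | no ¬cx | _      = collapse-injective ¬cx eq
  ... | yes _  | no ¬cy = sym (collapse-injective ¬cy (sym eq))
  ... | yes cx | yes cy with pair-pigeonhole cv cx cy
  ...   | inj₁ v≡x        = ⊥-elim (x≢v (sym v≡x))
  ...   | inj₂ (inj₁ v≡y) = ⊥-elim (y≢v (sym v≡y))
  ...   | inj₂ (inj₂ x≡y) = x≡y

  collapse-onto-off : ∀ {v} → Central v → ∀ t → ∃ λ y → y ≢ v × collapse y ≡ t
  collapse-onto-off (inj₂ refl) t = punchIn j t , punchInᵢ≢i j t , collapse-punchIn t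
    where
    collapse-punchIn : ∀ t → collapse (punchIn j t) ≡ t
    collapse-punchIn t with j ≟ punchIn j t
    ... | yes j≡y = ⊥-elim (punchInᵢ≢i j t (sym j≡y))
    ... | no _    = trans (punchOut-cong j refl) (punchOut-punchIn j)
  collapse-onto-off (inj₁ refl) t with collapse-onto-off (inj₂ refl) t
  ... | y , y≢j , y↦t with y ≟ k
  ...   | no y≢k  = y , y≢k , y↦t
  ...   | yes refl = j , j≢k , trans (collapse-central (inj₂ refl)) (trans (sym (collapse-central (inj₁ refl))) y↦t)

module RainbowTrees {N : ℕ} (G : Multigraph (suc (suc N))) (col : Edge G → Fin (suc N))
  {k j : Fin (suc (suc N))} (k≢j : k ≢ j)
  (stars : ∀ c → ∃ λ v → ((v ≡ k) ⊎ (v ≡ j)) × SpanningStarWithCenter G (ColorClass G col c) v)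
  where

  open Multigraph G using (m; ends)
  open MultigraphFacts G
  open Collapse k≢j
  open Modular

  class : Fin (suc N) → Subset m
  class = ColorClass G col

  center : Fin (suc N) → Fin (suc (suc N))
  center c = proj₁ (stars c)

  center-central : ∀ c → Central (center c)
  center-central c = proj₁ (proj₂ (stars c))

  class-acyclic : ∀ c → Acyclic G (class c)
  class-acyclic c = proj₁ (proj₂ (proj₁ (proj₂ (proj₂ (stars c)))))

  class-spanning : ∀ c → Spanning G (class c)
  class-spanning c = proj₂ (proj₂ (proj₁ (proj₂ (proj₂ (stars c)))))

  class-at-center : ∀ c {e} → e ∈ class c → Incident G e (center c)
  class-at-center c = proj₂ (proj₂ (proj₂ (stars c))) _

  ∈-class : ∀ e → e ∈ class (col e)
  ∈-class e = ∈-fiber⁺ col refl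

  loopless : ∀ {e a} → ¬ Joins G e a a
  loopless {e} = Acyclic⇒Loopless (class-acyclic (col e)) (∈-class e)

  central-end : ∀ e → ∃ λ w → Central w × ∃ λ y → Joins G e w y
  central-end e = center (col e) , center-central (col e) , Incident⇒Joins (class-at-center (col e) (∈-class e))

  has-central-end : ∀ {e a b} → Joins G e a b → Central a ⊎ Central b
  has-central-end {e} e-ab with central-end e
  ... | w , cw , y , e-wy with Joins-unique e-wy e-ab
  ...   | inj₁ (refl , _) = inj₁ cw
  ...   | inj₂ (refl , _) = inj₂ cw

  label-ends : Fin (suc (suc N)) × Fin (suc (suc N)) → Fin (suc N)
  label-ends (a , b) with central? a
  ... | yes _ = collapse b
  ... | no _  = collapse a

  label-endsˡ : ∀ {a} b → Central a → label-ends (a , b) ≡ collapse b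
  label-endsˡ {a} b ca with central? a
  ... | yes _  = refl
  ... | no ¬ca = ⊥-elim (¬ca ca)

  label-endsʳ : ∀ {a} b → Central a → label-ends (b , a) ≡ collapse b
  label-endsʳ {a} b ca with central? b
  ... | yes cb = trans (collapse-central ca) (sym (collapse-central cb))
  ... | no _   = refl

  label : Edge G → Fin (suc N)
  label e = label-ends (ends e)

  label-joins : ∀ {e a b} → Central a → Joins G e a b → label e ≡ collapse b
  label-joins {b = b} ca (inj₁ e≡ab) = trans (cong label-ends e≡ab) (label-endsˡ b ca)
  label-joins {b = b} ca (inj₂ e≡ba) = trans (cong label-ends e≡ba) (label-endsʳ b ca)

  label-noncentral : ∀ {e x p} → ¬ Central x → Joins G e x p → label e ≡ collapse x
  label-noncentral ¬cx e-xp with has-central-end e-xp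
  ... | inj₁ cx = ⊥-elim (¬cx cx)
  ... | inj₂ cp = label-joins cp (Joins-sym e-xp)

  label-injective-on-class : ∀ {c e e′} → e ∈ class c → e′ ∈ class c → label e ≡ label e′ → e ≡ e′
  label-injective-on-class {c} {e} {e′} e∈ e′∈ same-label
    with Incident⇒Joins (class-at-center c e∈) | Incident⇒Joins (class-at-center c e′∈)
  ... | x , e-vx | y , e′-vy =
    Acyclic⇒NoParallelEdges (class-acyclic c) e∈ e′∈ e-vx (subst (Joins G e′ (center c)) (sym x≡y) e′-vy)
    where
    cv = center-central c
    x≡y : x ≡ y
    x≡y = collapse-injective-off cv
      (λ x≡v → loopless (subst (Joins G e (center c)) x≡v e-vx))
      (λ y≡v → loopless (subst (Joins G e′ (center c)) y≡v e′-vy))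
      (trans (sym (label-joins cv e-vx)) (trans same-label (label-joins cv e′-vy)))

  class-has-label : ∀ c t → ∃ λ e → e ∈ class c × label e ≡ t
  class-has-label c t with collapse-onto-off (center-central c) t
  ... | y , y≢v , y↦t with class-spanning c y
  ...   | e , e∈ , e-at-y with Incident⇒Joins (class-at-center c e∈) | Incident⇒Joins e-at-y
  ...     | x , e-vx | _ , e-y with Joins-unique e-vx e-y
  ...       | inj₁ (v≡y , _)   = ⊥-elim (y≢v (sym v≡y))
  ...       | inj₂ (_ , refl) = e , e∈ , trans (label-joins (center-central c) e-vx) y↦t

  slot : Edge G → Fin (suc N)
  slot e = label e ⊕ col e

  tree : Fin (suc N) → Subset m
  tree = fiber slot

  tree-decomposition : Decomposition G tree
  tree-decomposition = fiber-decomposition slot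

  tree-rainbow : ∀ i → Rainbow G col (tree i)
  tree-rainbow i e e′ e∈ e′∈ same-col =
    label-injective-on-class (∈-class e) (subst (λ c → e′ ∈ class c) (sym same-col) (∈-class e′))
      (⊕-cancelʳ (col e) (trans (∈-fiber⁻ slot e∈) (trans (sym (∈-fiber⁻ slot e′∈)) (cong (label e′ ⊕_) (sym same-col)))))

  label-injective-on-tree : ∀ {i e e′} → e ∈ tree i → e′ ∈ tree i → label e ≡ label e′ → e ≡ e′
  label-injective-on-tree {i} {e} {e′} e∈ e′∈ same-label = tree-rainbow i e e′ e∈ e′∈
    (⊕-cancelˡ (label e) (trans (∈-fiber⁻ slot e∈) (trans (sym (∈-fiber⁻ slot e′∈)) (cong (_⊕ col e′) (sym same-label)))))

  tree-has-colour : ∀ i c → ∃ λ e → e ∈ tree i × col e ≡ c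
  tree-has-colour i c with class-has-label c (i ⊖ c)
  ... | e , e∈ , e↦i⊖c = e , ∈-fiber⁺ slot slot≡i , ∈-fiber⁻ col e∈
    where
    slot≡i : slot e ≡ i
    slot≡i = trans (cong₂ _⊕_ e↦i⊖c (∈-fiber⁻ col e∈)) (⊖-⊕-cancel i c)

  tree-has-label : ∀ i t → ∃ λ e → e ∈ tree i × label e ≡ t
  tree-has-label i t with class-has-label (i ⊖ t) t
  ... | e , e∈ , e↦t = e , ∈-fiber⁺ slot slot≡i , e↦t
    where
    slot≡i : slot e ≡ i
    slot≡i = trans (cong₂ _⊕_ e↦t (∈-fiber⁻ col e∈)) (trans (⊕-comm t (i ⊖ t)) (⊖-⊕-cancel i t))

  tree-size : ∀ i → ∣ tree i ∣ ≡ suc N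
  tree-size i = bijection⇒∣p∣≡n (tree i) col (proj₁ ∘ tree-has-colour i)
    (λ e∈ e′∈ → tree-rainbow i _ _ e∈ e′∈)
    (proj₁ ∘ proj₂ ∘ tree-has-colour i) (proj₂ ∘ proj₂ ∘ tree-has-colour i)

  tree-spanning : ∀ i → Spanning G (tree i)
  tree-spanning i x with central? x
  ... | no ¬cx with tree-has-label i (collapse x)
  ...   | e , e∈ , e↦x with central-end e
  ...     | w , cw , y , e-wy =
    e , e∈ , Joins⇒Incidentʳ (subst (Joins G e w) (sym x≡y) e-wy)
    where
    x≡y : x ≡ y
    x≡y = collapse-injective ¬cx (trans (sym e↦x) (label-joins cw e-wy))
  tree-spanning i x | yes cx with tree-has-label i hub
  ...   | e , e∈ , e↦hub with central-end e
  ...     | w , cw , y , e-wy with central? y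
  ...       | no ¬cy = ⊥-elim (collapse-noncentral ¬cy (trans (sym (label-joins cw e-wy)) e↦hub))
  ...       | yes cy with pair-pigeonhole cx cw cy
  ...         | inj₁ refl        = e , e∈ , Joins⇒Incidentˡ e-wy
  ...         | inj₂ (inj₁ refl) = e , e∈ , Joins⇒Incidentʳ e-wy
  ...         | inj₂ (inj₂ refl) = ⊥-elim (loopless e-wy)

  tree-acyclic : ∀ i → Acyclic G (tree i)
  tree-acyclic i = acyclic-if-degree≤1-off-pair k j (λ _ → loopless) no-parallel degree≤1
    where
    no-parallel : NoParallelEdges (tree i)
    no-parallel e∈ e′∈ e-ab e′-ab with has-central-end e-ab
    ... | inj₁ ca = label-injective-on-tree e∈ e′∈
                      (trans (label-joins ca e-ab) (sym (label-joins ca e′-ab)))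
    ... | inj₂ cb = label-injective-on-tree e∈ e′∈
                      (trans (label-joins cb (Joins-sym e-ab)) (sym (label-joins cb (Joins-sym e′-ab))))

    degree≤1 : ∀ x → x ≢ k → x ≢ j → DegreeAtMostOne (tree i) x
    degree≤1 x x≢k x≢j e∈ e′∈ e-xp e′-xq = label-injective-on-tree e∈ e′∈
      (trans (label-noncentral ¬cx e-xp) (sym (label-noncentral ¬cx e′-xq)))
      where
      ¬cx : ¬ Central x
      ¬cx (inj₁ x≡k) = x≢k x≡k
      ¬cx (inj₂ x≡j) = x≢j x≡j

theorem3p7 : (n : ℕ) (G : Multigraph n)
    → (col : Edge G → Fin (n ∸ 1))
    → (k j : Fin n) → k ≢ j
    → (∀ c → ∃ λ v → ((v ≡ k) ⊎ (v ≡ j)) × SpanningStarWithCenter G (ColorClass G col c) v)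
    → ∃ λ (T : Fin (n ∸ 1) → Subset (Multigraph.m G))
    → Decomposition G T × (∀ i → Rainbow G col (T i) × SpanningTree G (T i))
theorem3p7 zero          G col ()   j    k≢j stars
theorem3p7 (suc zero)    G col zero zero k≢j stars = ⊥-elim (k≢j refl)
theorem3p7 (suc (suc N)) G col k    j    k≢j stars =
  tree , tree-decomposition ,
  λ i → tree-rainbow i , tree-size i , tree-acyclic i , tree-spanning i
  where open RainbowTrees G col k≢j stars
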